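{- $14$ flanks $22$ at distance $1$ at every occurrence; that is, there is at least one $k\ge 0$ with $22\in S_k$, and for every $k\ge 1$ with $22\in S_k$ we have $14\in S_{k-1}$ and $14\in S_{k+1}$.
   Context: For integers $k\ge 0$ and $n\ge 1$, $\sigma_k(n)=\sum_{d\mid n} d^k$ and $\phi(n)$ is Euler's totient function. For each $k\geq 0$, $S_k$ denotes the set of composite positive integers $n$ satisfying $n\cdot\sigma_k(n)\equiv 2 \pmod{\phi(n)}$. For $\ell\in\mathbb{N}$ and $k\ge \ell$, $n_*$ flanks $n$ at distance $\ell$ at $k$ if $n\in S_k$, $n_*\in S_{k-\ell}$ and $n_*\in S_{k+\ell}$. If $n_*$ flanks $n$ at distance $\ell$ at $k$ for every $k$ for which $n\in S_k$ (and there is at least one such $k$), then $n_*$ (nontrivially) flanks $n$ at every occurrence. -}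

module Defs where

open import Data.Nat using (ℕ; zero; suc; _^_; _≤_)
open import Data.Nat.Divisibility using (_∣?_)
open import Data.Nat.GCD using (gcd)
open import Data.Nat.Primality using (Composite)
open import Data.List using (List; filter; length; map; upTo)
open import Data.Nat.ListAction using (sum)
open import Data.Integer as ℤ using (ℤ; +_)
import Data.Integer.Divisibility as ℤDiv
open import Relation.Binary.PropositionalEquality using (_≡_)
open import Data.Nat.Properties using (_≟_)
open import Data.Product using (_×_)

range1 : ℕ → List ℕ
range1 n = map suc (upTo n)

divisors : ℕ → List ℕ
divisors n = filter (λ d → d ∣? n) (range1 n)

σ : ℕ → ℕ → ℕ
σ k n = sum (map (λ d → d ^ k) (divisors n))

φ : ℕ → ℕ
φ n = length (filter (λ i → gcd i n ≟ 1) (range1 n))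

_≡_[mod_] : ℕ → ℕ → ℕ → Set
a ≡ b [mod m ] = (+ m) ℤDiv.∣ ((+ a) ℤ.- (+ b))

InS : ℕ → ℕ → Set
InS k n = Composite n × ((n Data.Nat.* σ k n) ≡ 2 [mod φ n ])

{-# OPTIONS --safe #-}
-- φ(22) = 10 and 22·d⁴ ≡ 22 (mod 10) for every divisor d of 22, so 22·σ_k(22) mod 10, and with
-- it the membership 22 ∈ S_k, depends only on k mod 4; likewise φ(14) = 6 and 14·d² ≡ 14 (mod 6)
-- for every divisor d of 14, so 14 ∈ S_k depends only on k mod 2. Checking the residues,
-- 22 ∈ S_k exactly when k ≡ 1 (mod 4), and 14 ∈ S_0; so k ± 1 is even and 14 ∈ S_{k±1}.
module Submission where

open import Defs
open import Data.Nat using (ℕ; suc; _∸_; _+_; _≥_; _*_; _^_; _<_; _%_; _/_; NonZero; s≤s)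
open import Data.Product using (_×_; ∃-syntax; _,_; map₂)

open import Level using (0ℓ)
open import Data.Nat.Properties using (+-comm; +-assoc; *-assoc; *-distribˡ-+; ^-distribˡ-+-*)
open import Data.Nat.DivMod using (m≡m%n+[m/n]*n; m%n<n; m*n%n≡0)
open import Data.Nat.Divisibility using (_∣_; _∣?_; _∣0)
open import Data.Nat.ListAction using (sum)
open import Data.Nat.Primality using (composite?)
import Data.Nat.Tactic.RingSolver as ℕ-Solver
open import Data.Integer as ℤ using (+_; -_)
open import Data.Integer.Properties using (+-inverseʳ; pos-+; pos-*)
open import Data.Integer.Divisibility.Signed as Signed using (∣ᵤ⇒∣; ∣⇒∣ᵤ; ∣m∣n⇒∣m+n; ∣m⇒∣-m; ∣m⇒∣m*n)
import Data.Integer.Tactic.RingSolver as ℤ-Solver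
open import Data.List using (List; []; _∷_; map)
open import Data.List.Relation.Unary.All using (All; []; _∷_; all?)
open import Function.Bundles using (_⇔_; mk⇔; Equivalence)
open import Relation.Binary.Bundles using (Setoid)
open import Relation.Binary.Structures using (IsEquivalence)
open import Relation.Binary.PropositionalEquality using (_≡_; refl; sym; trans; cong; cong₂; subst; module ≡-Reasoning)
open import Relation.Nullary using (Dec; contradiction)
open import Relation.Nullary.Decidable using (_×-dec_; from-yes; from-no)
import Relation.Binary.Reasoning.Setoid as SetoidReasoning

module _ {m : ℕ} where

  private
    signed : ∀ a b → a ≡ b [mod m ] → + m Signed.∣ (+ a ℤ.- + b)
    signed a b = ∣ᵤ⇒∣

  ≡-mod-refl : ∀ a → a ≡ a [mod m ]
  ≡-mod-refl a = subst (λ i → m ∣ ℤ.∣ i ∣) (sym (+-inverseʳ (+ a))) (m ∣0)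

  ≡-mod-sym : ∀ {a b} → a ≡ b [mod m ] → b ≡ a [mod m ]
  ≡-mod-sym {a} {b} a≡b = ∣⇒∣ᵤ (subst (+ m Signed.∣_) (neg-diff (+ a) (+ b)) (∣m⇒∣-m (signed a b a≡b)))
    where
    neg-diff : ∀ x y → - (x ℤ.- y) ≡ y ℤ.- x
    neg-diff = ℤ-Solver.solve-∀

  ≡-mod-trans : ∀ {a b c} → a ≡ b [mod m ] → b ≡ c [mod m ] → a ≡ c [mod m ]
  ≡-mod-trans {a} {b} {c} a≡b b≡c =
    ∣⇒∣ᵤ (subst (+ m Signed.∣_) (telescope (+ a) (+ b) (+ c)) (∣m∣n⇒∣m+n (signed a b a≡b) (signed b c b≡c)))
    where
    telescope : ∀ x y z → (x ℤ.- y) ℤ.+ (y ℤ.- z) ≡ x ℤ.- z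
    telescope = ℤ-Solver.solve-∀

  ≡-mod-+ : ∀ a b c d → a ≡ b [mod m ] → c ≡ d [mod m ] → (a + c) ≡ (b + d) [mod m ]
  ≡-mod-+ a b c d a≡b c≡d =
    ∣⇒∣ᵤ (subst (+ m Signed.∣_) diff-of-sums (∣m∣n⇒∣m+n (signed a b a≡b) (signed c d c≡d)))
    where
    regroup : ∀ w x y z → (w ℤ.- x) ℤ.+ (y ℤ.- z) ≡ (w ℤ.+ y) ℤ.- (x ℤ.+ z)
    regroup = ℤ-Solver.solve-∀
    diff-of-sums : (+ a ℤ.- + b) ℤ.+ (+ c ℤ.- + d) ≡ + (a + c) ℤ.- + (b + d)
    diff-of-sums = trans (regroup (+ a) (+ b) (+ c) (+ d)) (sym (cong₂ ℤ._-_ (pos-+ a c) (pos-+ b d)))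

  ≡-mod-*ʳ : ∀ a b c → a ≡ b [mod m ] → (a * c) ≡ (b * c) [mod m ]
  ≡-mod-*ʳ a b c a≡b =
    ∣⇒∣ᵤ (subst (+ m Signed.∣_) diff-of-products (∣m⇒∣m*n (+ c) (signed a b a≡b)))
    where
    distrib : ∀ x y z → (x ℤ.- y) ℤ.* z ≡ x ℤ.* z ℤ.- y ℤ.* z
    distrib = ℤ-Solver.solve-∀
    diff-of-products : (+ a ℤ.- + b) ℤ.* + c ≡ + (a * c) ℤ.- + (b * c)
    diff-of-products = trans (distrib (+ a) (+ b) (+ c)) (sym (cong₂ ℤ._-_ (pos-* a c) (pos-* b c)))

  ≡-mod-isEquivalence : IsEquivalence (λ a b → a ≡ b [mod m ])
  ≡-mod-isEquivalence = record
    { refl  = λ {a} → ≡-mod-refl a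
    ; sym   = λ {a} {b} → ≡-mod-sym {a} {b}
    ; trans = λ {a} {b} {c} → ≡-mod-trans {a} {b} {c}
    }

≡-mod-setoid : ℕ → Setoid 0ℓ 0ℓ
≡-mod-setoid m = record { isEquivalence = ≡-mod-isEquivalence {m} }

module ≡-mod-Reasoning (m : ℕ) = SetoidReasoning (≡-mod-setoid m)

_≡?_[mod_] : ∀ a b m → Dec (a ≡ b [mod m ])
a ≡? b [mod m ] = m ∣? ℤ.∣ + a ℤ.- + b ∣

powerSum : ℕ → List ℕ → ℕ
powerSum k ds = sum (map (λ d → d ^ k) ds)

*-powerSum-shift : ∀ {m n p ds} → All (λ d → (n * d ^ p) ≡ n [mod m ]) ds →
                   ∀ k → (n * powerSum (p + k) ds) ≡ (n * powerSum k ds) [mod m ]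
*-powerSum-shift {n = n} [] k = ≡-mod-refl (n * 0)
*-powerSum-shift {m} {n} {p} {d ∷ ds} (nd^p≡n ∷ rest) k = begin
  n * (d ^ (p + k) + powerSum (p + k) ds)      ≡⟨ *-distribˡ-+ n _ _ ⟩
  n * d ^ (p + k) + n * powerSum (p + k) ds    ≡⟨ cong (_+ n * powerSum (p + k) ds) n*d^[p+k] ⟩
  n * d ^ p * d ^ k + n * powerSum (p + k) ds  ≈⟨ ≡-mod-+ (n * d ^ p * d ^ k) (n * d ^ k) (n * powerSum (p + k) ds) (n * powerSum k ds)
                                                      (≡-mod-*ʳ (n * d ^ p) n (d ^ k) nd^p≡n) (*-powerSum-shift {m} {n} {p} rest k) ⟩
  n * d ^ k + n * powerSum k ds                ≡⟨ *-distribˡ-+ n _ _ ⟨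
  n * (d ^ k + powerSum k ds)                  ∎
  where
  open ≡-mod-Reasoning m
  n*d^[p+k] : n * d ^ (p + k) ≡ n * d ^ p * d ^ k
  n*d^[p+k] = trans (cong (n *_) (^-distribˡ-+-* d p k)) (sym (*-assoc n (d ^ p) (d ^ k)))

SPeriod : ℕ → ℕ → Set
SPeriod n p = All (λ d → (n * d ^ p) ≡ n [mod φ n ]) (divisors n)

SPeriod? : ∀ n p → Dec (SPeriod n p)
SPeriod? n p = all? (λ d → (n * d ^ p) ≡? n [mod φ n ]) (divisors n)

*-σ-periodic : ∀ {n p} → SPeriod n p → ∀ q k → (n * σ (q * p + k) n) ≡ (n * σ k n) [mod φ n ]
*-σ-periodic {n} per 0 k = ≡-mod-refl (n * σ k n)
*-σ-periodic {n} {p} per (suc q) k = begin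
  n * σ (suc q * p + k) n    ≡⟨ cong (λ j → n * σ j n) (+-assoc p (q * p) k) ⟩
  n * σ (p + (q * p + k)) n  ≈⟨ *-powerSum-shift {φ n} {n} {p} per (q * p + k) ⟩
  n * σ (q * p + k) n        ≈⟨ *-σ-periodic {n} {p} per q k ⟩
  n * σ k n                  ∎
  where open ≡-mod-Reasoning (φ n)

InS⇔InS-mod : ∀ {n p} .{{_ : NonZero p}} → SPeriod n p → ∀ k → InS k n ⇔ InS (k % p) n
InS⇔InS-mod {n} {p} per k = mk⇔ (map₂ λ h → begin
    n * σ (k % p) n  ≈⟨ reduce ⟨
    n * σ k n        ≈⟨ h ⟩
    2                ∎)
  (map₂ λ h → begin
    n * σ k n        ≈⟨ reduce ⟩
    n * σ (k % p) n  ≈⟨ h ⟩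
    2                ∎)
  where
  open ≡-mod-Reasoning (φ n)
  reduce : (n * σ k n) ≡ (n * σ (k % p) n) [mod φ n ]
  reduce = begin
    n * σ k n                      ≡⟨ cong (λ j → n * σ j n) (trans (m≡m%n+[m/n]*n k p) (+-comm (k % p) _)) ⟩
    n * σ (k / p * p + k % p) n    ≈⟨ *-σ-periodic {n} {p} per (k / p) (k % p) ⟩
    n * σ (k % p) n                ∎

InS? : ∀ k n → Dec (InS k n)
InS? k n = composite? n ×-dec ((n * σ k n) ≡? 2 [mod φ n ])

22∈S⇒≡1-mod-4 : ∀ k → InS k 22 → k % 4 ≡ 1
22∈S⇒≡1-mod-4 k 22∈Sₖ =
  residue (k % 4) (m%n<n k 4) (Equivalence.to (InS⇔InS-mod {22} {4} (from-yes (SPeriod? 22 4)) k) 22∈Sₖ)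
  where
  residue : ∀ r → r < 4 → InS r 22 → r ≡ 1
  residue 0 _ 22∈S₀ = contradiction 22∈S₀ (from-no (InS? 0 22))
  residue 1 _ _     = refl
  residue 2 _ 22∈S₂ = contradiction 22∈S₂ (from-no (InS? 2 22))
  residue 3 _ 22∈S₃ = contradiction 22∈S₃ (from-no (InS? 3 22))
  residue (suc (suc (suc (suc _)))) (s≤s (s≤s (s≤s (s≤s ())))) _

14∈S-even : ∀ j → j % 2 ≡ 0 → InS j 14
14∈S-even j j%2≡0 =
  Equivalence.from (InS⇔InS-mod {14} {2} (from-yes (SPeriod? 14 2)) j)
    (subst (λ r → InS r 14) (sym j%2≡0) (from-yes (InS? 0 14)))

≡1-mod-4⇒neighbours-even : ∀ k → k % 4 ≡ 1 → (k ∸ 1) % 2 ≡ 0 × (k + 1) % 2 ≡ 0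
≡1-mod-4⇒neighbours-even k k%4≡1 = below , above
  where
  open ≡-Reasoning
  q = k / 4
  k≡1+q*4 : k ≡ 1 + q * 4
  k≡1+q*4 = trans (m≡m%n+[m/n]*n k 4) (cong (_+ q * 4) k%4≡1)
  below : (k ∸ 1) % 2 ≡ 0
  below = begin
    (k ∸ 1) % 2      ≡⟨ cong (λ x → (x ∸ 1) % 2) k≡1+q*4 ⟩
    (q * 4) % 2      ≡⟨ cong (_% 2) (*-assoc q 2 2) ⟨
    (q * 2 * 2) % 2  ≡⟨ m*n%n≡0 (q * 2) 2 ⟩
    0                ∎
  above : (k + 1) % 2 ≡ 0
  above = begin
    (k + 1) % 2            ≡⟨ cong (λ x → (x + 1) % 2) k≡1+q*4 ⟩
    (1 + q * 4 + 1) % 2    ≡⟨ cong (_% 2) (regroup q) ⟩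
    ((1 + q * 2) * 2) % 2  ≡⟨ m*n%n≡0 (1 + q * 2) 2 ⟩
    0                      ∎
    where
    regroup : ∀ x → 1 + x * 4 + 1 ≡ (1 + x * 2) * 2
    regroup = ℕ-Solver.solve-∀

corollary2p4 : (∃[ k ] InS k 22) × (∀ k → k ≥ 1 → InS k 22 → InS (k ∸ 1) 14 × InS (k + 1) 14)
corollary2p4 = (1 , from-yes (InS? 1 22)) , flanks
  where
  flanks : ∀ k → k ≥ 1 → InS k 22 → InS (k ∸ 1) 14 × InS (k + 1) 14
  flanks k _ 22∈Sₖ =
    let below , above = ≡1-mod-4⇒neighbours-even k (22∈S⇒≡1-mod-4 k 22∈Sₖ)
    in  14∈S-even (k ∸ 1) below , 14∈S-even (k + 1) above
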